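{- Let $(G,w)$ be a weighted trigraph, let $S\subseteq R\subseteq V(G)$, and assume that $S$ is a stable set of $G$. Then $\sum_{u\in S}w(u)\le \alpha(\mathrm{Red}[G,w;R])+\mathrm{Ext}[G,w;R]$.
   Context: A trigraph $G$ consists of a finite set $V(G)$ and a function $\theta_G:\binom{V(G)}{2}\to\{ -1,0,1\}$; for distinct vertices $u,v$ write $uv$ for $\{u,v\}$; it is semi-adjacent if $\theta_G(uv)=0$, and $u,v$ are anti-adjacent if $\theta_G(uv)\le 0$. A stable set is a set of pairwise anti-adjacent vertices. $G[R]$ is the trigraph on $R$ with $\theta_G$ restricted. Let $D(G)=V(G)\cup\{(u,v): u,v\in V(G),u\neq v\}\cup\binom{V(G)}{2}$. A weight function for $G$ is a map $w:D(G)\to\mathbb{N}$ such that for all distinct $u,v$: if $uv$ is not semi-adjacent then $w(u,v)=w(v,u)=w(uv)=0$, and $w(u,v)\le w(uv)$. A weighted trigraph is a pair $(G,w)$. For $S\subseteq V(G)$, $\mathrm{wt}_{(G,w)}(S)=\sum_{u\in S}w(u)+\sum_{u\in S}\sum_{v\in V(G)\setminus S}w(u,v)+\sum_{uv\in\binom{V(G)\setminus S}{2}}w(uv)$, and $\alpha(G,w)=\max\{\mathrm{wt}_{(G,w)}(S): S\text{ stable in }G\}$. For $R\subseteq V(G)$, $\mathrm{Red}[G,w;R]$ is the weighted trigraph $(G[R],w')$ where $w'(u)=\max\{w(u)-\sum_{v\in V(G)\setminus R}(w(uv)-w(u,v)),0\}$ for $u\in R$, and $w'(u,v)=w(u,v)$,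 $w'(uv)=w(uv)$ for distinct $u,v\in R$; and $\mathrm{Ext}[G,w;R]=\sum_{uv\in\binom{V(G)\setminus R}{2}}w(uv)+\sum_{u\in R}\sum_{v\in V(G)\setminus R}w(uv)$. -}

module Defs where

open import Data.Nat using (ℕ; zero; suc; _+_; _∸_; _⊔_; _≤_; _<ᵇ_)
open import Data.Bool using (Bool; true; false; if_then_else_; _∧_; _∨_; not)
open import Data.Fin using (Fin; toℕ)
import Data.Fin
open import Data.Fin.Subset using (Subset; _∈_; _∉_; _⊆_)
open import Data.Vec using (Vec; []; _∷_; lookup)
open import Data.List using (List; []; _∷_; map; _++_; foldr; filter)
open import Data.Product using (_×_; _,_)
open import Relation.Binary.PropositionalEquality using (_≡_; _≢_)
open import Relation.Nullary using (¬_)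
open import Data.Bool.Properties using (T?)

-- Values of θ_G : -1 (neg), 0 (zer), 1 (pos).
data Adj : Set where
  neg zer pos : Adj

isPos : Adj → Bool
isPos pos = true
isPos _   = false

-- A trigraph whose (finite) vertex set V is a subset of Fin n.
-- θ is a symmetric function; its values on the diagonal and outside V are irrelevant.
record Trigraph (n : ℕ) : Set where
  field
    V     : Subset n
    θ     : Fin n → Fin n → Adj
    θ-sym : ∀ u v → θ u v ≡ θ v u
open Trigraph public

-- Raw weights: w₀ u = w(u), w₁ u v = w(u,v) (ordered pair), w₂ u v = w(uv) (unordered pair).
record Weights (n : ℕ) : Set where
  field
    w₀ : Fin n → ℕ
    w₁ : Fin n → Fin n → ℕ
    w₂ : Fin n → Fin n → ℕ
open Weights public

-- w is a weight function for G (w₂ represents a function on unordered pairs, hence symmetric).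
record IsWeightFunction {n : ℕ} (G : Trigraph n) (w : Weights n) : Set where
  field
    w₂-sym   : ∀ u v → u ∈ V G → v ∈ V G → u ≢ v → w₂ w u v ≡ w₂ w v u
    not-semi : ∀ u v → u ∈ V G → v ∈ V G → u ≢ v → θ G u v ≢ zer →
               (w₁ w u v ≡ 0) × (w₁ w v u ≡ 0) × (w₂ w u v ≡ 0)
    w₁≤w₂    : ∀ u v → u ∈ V G → v ∈ V G → u ≢ v → w₁ w u v ≤ w₂ w u v

∑ : {n : ℕ} → (Fin n → ℕ) → ℕ
∑ {zero}  f = 0
∑ {suc n} f = f Data.Fin.zero + ∑ (λ i → f (Data.Fin.suc i))

all : {n : ℕ} → (Fin n → Bool) → Bool
all {zero}  f = true
all {suc n} f = f Data.Fin.zero ∧ all (λ i → f (Data.Fin.suc i))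

mem : {n : ℕ} → Subset n → Fin n → Bool
mem S u = lookup S u

[_]? : Bool → ℕ → ℕ
[ b ]? x = if b then x else 0

diff : {n : ℕ} → Subset n → Subset n → Fin n → Bool
diff A B u = mem A u ∧ not (mem B u)

Stable : {n : ℕ} → Trigraph n → Subset n → Set
Stable G S = (S ⊆ V G) × (∀ u v → u ∈ S → v ∈ S → u ≢ v → θ G u v ≢ pos)

distinct : {n : ℕ} → Fin n → Fin n → Bool
distinct u v = (toℕ u <ᵇ toℕ v) ∨ (toℕ v <ᵇ toℕ u)

stableᵇ : {n : ℕ} → Trigraph n → Subset n → Bool
stableᵇ G S =
  all (λ u → not (mem S u) ∨ mem (V G) u) ∧
  all (λ u → all (λ v → not (mem S u ∧ mem S v ∧ distinct u v ∧ isPos (θ G u v))))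

wt : {n : ℕ} → Trigraph n → Weights n → Subset n → ℕ
wt G w S =
  ∑ (λ u → [ mem S u ]? (w₀ w u)) +
  ∑ (λ u → [ mem S u ]? (∑ (λ v → [ diff (V G) S v ]? (w₁ w u v)))) +
  ∑ (λ u → ∑ (λ v → [ diff (V G) S u ∧ diff (V G) S v ∧ (toℕ u <ᵇ toℕ v) ]? (w₂ w u v)))

subsets : (n : ℕ) → List (Subset n)
subsets zero    = [] ∷ []
subsets (suc n) = map (true ∷_) (subsets n) ++ map (false ∷_) (subsets n)

maxList : List ℕ → ℕ
maxList = foldr _⊔_ 0

α : {n : ℕ} → Trigraph n → Weights n → ℕ
α G w = maxList (map (wt G w) (filter (λ S → T? (stableᵇ G S)) (subsets _)))

induced : {n : ℕ} → Trigraph n → Subset n → Trigraph n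
induced G R = record { V = R ; θ = θ G ; θ-sym = θ-sym G }

-- Red[G,w;R] (weights; w'(u) = max{w(u) - Σ_{v ∈ V(G)\R} (w(uv) - w(u,v)), 0}, truncated subtraction)
redWeights : {n : ℕ} → Trigraph n → Weights n → Subset n → Weights n
redWeights G w R = record
  { w₀ = λ u → w₀ w u ∸ ∑ (λ v → [ diff (V G) R v ]? (w₂ w u v ∸ w₁ w u v))
  ; w₁ = w₁ w
  ; w₂ = w₂ w
  }

αRed : {n : ℕ} → Trigraph n → Weights n → Subset n → ℕ
αRed G w R = α (induced G R) (redWeights G w R)

Ext : {n : ℕ} → Trigraph n → Weights n → Subset n → ℕ
Ext G w R =
  ∑ (λ u → ∑ (λ v → [ diff (V G) R u ∧ diff (V G) R v ∧ (toℕ u <ᵇ toℕ v) ]? (w₂ w u v))) +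
  ∑ (λ u → [ mem R u ]? (∑ (λ v → [ diff (V G) R v ]? (w₂ w u v))))

module Submission where

-- Write w' for the reduced weights.  For u ∈ R the reduction removes
-- Y(u) = ∑_{v ∈ V(G)∖R} (w(uv) ∸ w(u,v)), which is at most
-- X(u) = ∑_{v ∈ V(G)∖R} w(uv); hence w(u) ≤ w'(u) + X(u).  Summing over S ⊆ R,
--   ∑_S w ≤ ∑_S w' + ∑_R X.
-- The first term is part of wt_{Red}(S) ≤ α(Red[G,w;R]), since S is stable in
-- G[R]; the second is the second summand of Ext[G,w;R].

open import Defs
open import Data.Nat using (ℕ; _+_; _≤_)
open import Data.Fin.Subset using (Subset; _⊆_)

open import Data.Nat using (zero; suc; _∸_; _<ᵇ_; z≤n)
open import Data.Nat.Properties
open import Data.Bool using (Bool; true; false; T; _∧_; _∨_; not)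
open import Data.Bool.Properties using (T?; T-∧)
open import Data.Fin using (Fin; toℕ)
import Data.Fin as F
open import Data.Vec using ([]; _∷_)
open import Data.Vec.Properties using ([]=⇒lookup; lookup⇒[]=)
open import Data.List using (map)
import Data.List as L
open import Data.List.Membership.Propositional using () renaming (_∈_ to _∈ₗ_)
open import Data.List.Membership.Propositional.Properties using (∈-filter⁺; ∈-map⁺; ∈-++⁺ˡ; ∈-++⁺ʳ)
open import Data.List.Relation.Unary.Any using (here; there)
open import Data.Product using (_,_)
open import Data.Unit using (tt)
open import Data.Empty using (⊥)
open import Function.Bundles using (Equivalence)
open import Relation.Binary.PropositionalEquality
open import Algebra.Properties.CommutativeSemigroup +-commutativeSemigroup using (interchange)

∑-mono : ∀ {n} {f g : Fin n → ℕ} → (∀ i → f i ≤ g i) → ∑ f ≤ ∑ g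
∑-mono {zero}  f≤g = z≤n
∑-mono {suc n} f≤g = +-mono-≤ (f≤g F.zero) (∑-mono (λ i → f≤g (F.suc i)))

∑-+ : ∀ {n} (f g : Fin n → ℕ) → ∑ (λ i → f i + g i) ≡ ∑ f + ∑ g
∑-+ {zero}  f g = refl
∑-+ {suc n} f g = begin
    f F.zero + g F.zero + ∑ (λ i → f (F.suc i) + g (F.suc i))
      ≡⟨ cong (f F.zero + g F.zero +_) (∑-+ (λ i → f (F.suc i)) (λ i → g (F.suc i))) ⟩
    f F.zero + g F.zero + (∑ (λ i → f (F.suc i)) + ∑ (λ i → g (F.suc i)))
      ≡⟨ interchange (f F.zero) (g F.zero) _ _ ⟩
    f F.zero + ∑ (λ i → f (F.suc i)) + (g F.zero + ∑ (λ i → g (F.suc i))) ∎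
  where open ≡-Reasoning

[]?-mono : ∀ b {x y} → x ≤ y → [ b ]? x ≤ [ b ]? y
[]?-mono true  x≤y = x≤y
[]?-mono false x≤y = z≤n

maxList-≥ : ∀ {x xs} → x ∈ₗ xs → x ≤ maxList xs
maxList-≥ {xs = y L.∷ ys} (here refl) = m≤m⊔n y (maxList ys)
maxList-≥ {xs = y L.∷ ys} (there x∈ys) = ≤-trans (maxList-≥ x∈ys) (m≤n⊔m y (maxList ys))

∈-subsets : ∀ {n} (S : Subset n) → S ∈ₗ subsets n
∈-subsets {zero}  []          = here refl
∈-subsets {suc n} (true ∷ S)  = ∈-++⁺ˡ (∈-map⁺ (true ∷_) (∈-subsets S))
∈-subsets {suc n} (false ∷ S) =
  ∈-++⁺ʳ (map (true ∷_) (subsets n)) (∈-map⁺ (false ∷_) (∈-subsets S))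

all-intro : ∀ {n} (f : Fin n → Bool) → (∀ i → T (f i)) → T (all f)
all-intro {zero}  f h = tt
all-intro {suc n} f h =
  Equivalence.from T-∧ (h F.zero , all-intro (λ i → f (F.suc i)) (λ i → h (F.suc i)))

distinct⇒≢ : ∀ {n} (u v : Fin n) → T (distinct u v) → u ≢ v
distinct⇒≢ u .u d refl = irreflexive (toℕ u) d
  where
  irreflexive : ∀ m → T ((m <ᵇ m) ∨ (m <ᵇ m)) → ⊥
  irreflexive m d with m <ᵇ m in eq
  ... | true  = <-irrefl refl (<ᵇ⇒< m m (subst T (sym eq) tt))
  ... | false = d

isPos⇒≡pos : ∀ a → T (isPos a) → a ≡ pos
isPos⇒≡pos pos _ = refl

stable⇒stableᵇ : ∀ {n} (G : Trigraph n) {S R : Subset n} → S ⊆ R → Stable G S →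
                 T (stableᵇ (induced G R) S)
stable⇒stableᵇ G {S} {R} S⊆R (_ , anti) =
  Equivalence.from T-∧ (all-intro _ inside , all-intro _ λ u → all-intro _ (noEdge u))
  where
  inside : ∀ u → T (not (mem S u) ∨ mem R u)
  inside u with mem S u in u∈S
  ... | false = tt
  ... | true rewrite []=⇒lookup (S⊆R (lookup⇒[]= u S u∈S)) = tt
  noEdge : ∀ u v → T (not (mem S u ∧ mem S v ∧ distinct u v ∧ isPos (θ G u v)))
  noEdge u v with mem S u in u∈S | mem S v in v∈S | distinct u v in u≠v | isPos (θ G u v) in uv
  ... | false | _     | _     | _     = tt
  ... | true  | false | _     | _     = tt
  ... | true  | true  | false | _     = tt
  ... | true  | true  | true  | false = tt
  ... | true  | true  | true  | true  =
    anti u v (lookup⇒[]= u S u∈S) (lookup⇒[]= v S v∈S)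
         (distinct⇒≢ u v (subst T (sym u≠v) tt)) (isPos⇒≡pos _ (subst T (sym uv) tt))

wt≤α : ∀ {n} (G : Trigraph n) (w : Weights n) (S : Subset n) →
       T (stableᵇ G S) → wt G w S ≤ α G w
wt≤α G w S stable =
  maxList-≥ (∈-map⁺ (wt G w) (∈-filter⁺ (λ S → T? (stableᵇ G S)) (∈-subsets S) stable))

vertexWeight≤wt : ∀ {n} (G : Trigraph n) (w : Weights n) (S : Subset n) →
                  ∑ (λ u → [ mem S u ]? (w₀ w u)) ≤ wt G w S
vertexWeight≤wt G w S = ≤-trans (m≤m+n _ _) (m≤m+n _ _)

≤∸+ : ∀ a {y x} → y ≤ x → a ≤ (a ∸ y) + x
≤∸+ a {y} {x} y≤x = begin
    a            ≤⟨ m≤n+m∸n a y ⟩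
    y + (a ∸ y)  ≡⟨ +-comm y (a ∸ y) ⟩
    (a ∸ y) + y  ≤⟨ +-monoʳ-≤ (a ∸ y) y≤x ⟩
    (a ∸ y) + x  ∎
  where open ≤-Reasoning

outerWeight : ∀ {n} → Trigraph n → Weights n → Subset n → Fin n → ℕ
outerWeight G w R u = ∑ (λ v → [ diff (V G) R v ]? (w₂ w u v))

w₀≤red+outer : ∀ {n} (G : Trigraph n) (w : Weights n) (R : Subset n) (u : Fin n) →
               w₀ w u ≤ w₀ (redWeights G w R) u + outerWeight G w R u
w₀≤red+outer G w R u =
  ≤∸+ (w₀ w u) (∑-mono λ v → []?-mono (diff (V G) R v) (m∸n≤m (w₂ w u v) (w₁ w u v)))

vertexWeight≤red+outer : ∀ {n} (G : Trigraph n) (w : Weights n) {S R : Subset n} → S ⊆ R →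
  ∑ (λ u → [ mem S u ]? (w₀ w u)) ≤
  ∑ (λ u → [ mem S u ]? (w₀ (redWeights G w R) u)) + ∑ (λ u → [ mem R u ]? (outerWeight G w R u))
vertexWeight≤red+outer G w {S} {R} S⊆R =
  ≤-trans (∑-mono pointwise) (≤-reflexive (∑-+ (λ u → [ mem S u ]? (w₀ (redWeights G w R) u)) _))
  where
  pointwise : ∀ u → [ mem S u ]? (w₀ w u) ≤
                    [ mem S u ]? (w₀ (redWeights G w R) u) + [ mem R u ]? (outerWeight G w R u)
  pointwise u with mem S u in u∈S
  ... | false = z≤n
  ... | true rewrite []=⇒lookup (S⊆R (lookup⇒[]= u S u∈S)) = w₀≤red+outer G w R u

proposition3p7 : (n : ℕ) (G : Trigraph n) (w : Weights n) → IsWeightFunction G w →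
                 (S R : Subset n) → S ⊆ R → R ⊆ V G → Stable G S →
                 ∑ (λ u → [ mem S u ]? (w₀ w u)) ≤ αRed G w R + Ext G w R
proposition3p7 n G w _ S R S⊆R _ stable = begin
    ∑ (λ u → [ mem S u ]? (w₀ w u))
      ≤⟨ vertexWeight≤red+outer G w S⊆R ⟩
    ∑ (λ u → [ mem S u ]? (w₀ w' u)) + ∑ (λ u → [ mem R u ]? (outerWeight G w R u))
      ≤⟨ +-monoˡ-≤ _ reducedPart ⟩
    αRed G w R + ∑ (λ u → [ mem R u ]? (outerWeight G w R u))
      ≤⟨ +-monoʳ-≤ (αRed G w R) (m≤n+m _ _) ⟩
    αRed G w R + Ext G w R ∎
  where
  open ≤-Reasoning
  w' : Weights n
  w' = redWeights G w R
  reducedPart : ∑ (λ u → [ mem S u ]? (w₀ w' u)) ≤ αRed G w R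
  reducedPart = ≤-trans (vertexWeight≤wt (induced G R) w' S)
                        (wt≤α (induced G R) w' S (stable⇒stableᵇ G S⊆R stable))
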